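{- Let $m\geq1$ and $n_1,\dots,n_m\in\mathbb{N}$. Define $U_1=(\alpha\;(x\;\lambda d\lambda y\,(y\;\widehat{n_1})\;\mathbf{id}\;\alpha))$ and $U_k=(\alpha\;(x\;\lambda d\lambda y\,(y\;\widehat{n_k})\;\mathbf{id}\;(\mathcal I\;U_{k-1})))$ for $2\le k\le m$, and let $P_{n_1,\dots,n_m}=\lambda x\,\mu\alpha\,U_m$. Then $\vdash' P_{n_1,\dots,n_m}:\forall x\,\{\mathrm{Ent}[x]\rightarrow\exists y\,\mathrm{Ent}[y]\}$ and $(P_{n_1,\dots,n_m}\;\widehat{0})\rightarrow_{\mu^{++}}\{\lambda y\,(y\;\widehat{n_i}) : 1\le i\le m\}$.
   Context: $\lambda\mu^{++}$-terms: $t ::= x\mid\alpha\mid\lambda x\,t\mid\mu\alpha\,t\mid(t\;t)$ ($x$ $\lambda$-variables, $\alpha$ $\mu$-variables; binders $\lambda,\mu$; application left-associative). $\mathbf{id}=\lambda x\,x$, $\mathcal I=\lambda x\,\mu\alpha\,x$, and $\widehat{n}=\lambda x\lambda y\,(y^n\;x)$ with $(y^0\;x)=x$, $(y^{k+1}\;x)=(y\;(y^k\;x))$. One-step reduction $\rightharpoonup$ is the contextual closure of: $(C_\lambda)$ $(\lambda x\,u\;v)\rightharpoonup u[x:=v]$; $(C_\mu)$ $(\mu\alpha\,u\;v)\rightharpoonup\mu\beta\,u[\alpha:=\lambda y\,(\beta\;(y\;v))]$; $(S_1)$ $((\alpha\;u)\;v)\rightharpoonup(\alpha\;u)$; $(S_2)$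 $\mu\alpha\mu\beta\,u\rightharpoonup\mu\alpha\,u[\beta:=\mathbf{id}]$; $(S_3)$ $(\alpha\;(\beta\;u))\rightharpoonup(\beta\;u)$; $(S_4)$ $(\beta\;\mu\alpha\,u)\rightharpoonup u[\alpha:=\lambda y\,(\beta\;y)]$; $(S_5)$ $\mu\alpha\,u\rightharpoonup\lambda z\,\mu\beta\,u[\alpha:=\lambda y\,(\beta\;(y\;z))]$ if $u$ contains a subterm $(\alpha\;\lambda x\,v)$; $(S_6)$ $\mu\alpha\,u[y:=(\alpha\;v)]\rightharpoonup v$ if $y$ is free in $u$ and $\alpha$ not free in $v$. $t\rightharpoonup_{\mu^{++}}t'$: finitely many steps; normal: no step applies. For a set $\mathcal V$ of normal terms, $t\rightarrow_{\mu^{++}}\mathcal V$ means $t\rightharpoonup_{\mu^{++}}u$ for all $u\in\mathcal V$ and every normal $u$ with $t\rightharpoonup_{\mu^{++}}u$ is in $\mathcal V$. Types: second-order formulas with $\perp,\rightarrow,\forall x,\forall X$; $\neg A=A\rightarrow\perp$; $\exists x\,A=\neg\forall x\,\neg A$; $\{A_1,\dots,A_n\rightarrow A\}$ is $A_1\rightarrow(\dots\rightarrow(A_n\rightarrow A))$. $0$ constant, $s$ unary function symbol, $\mathrm{Ent}[x]=\forall X\,\{X(0),\forall y\,(X(y)\rightarrow X(sy))\rightarrow X(x)\}$. Typing $\Gamma\vdash' t:A$ (contexts $x_1:A_1,\dots,x_n:A_n,\alpha_1:\neg B_1,\dots,\alpha_m:\neg B_m$), for a fixed set $E$ of equations with induced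 equivalence $\approx_E$, is generated by: (1) $\Gamma\vdash' x_i:A_i$, $\Gamma\vdash'\alpha_j:\neg B_j$; (2) from $\Gamma,x:A\vdash' u:B$ infer $\Gamma\vdash'\lambda x\,u:A\rightarrow B$; (3) from $\Gamma_1\vdash' u:A\rightarrow B$, $\Gamma_2\vdash' v:A$ infer $\Gamma_1,\Gamma_2\vdash'(u\;v):B$; (4) from $\Gamma\vdash' u:A$, $x$ not free in $\Gamma$, infer $\Gamma\vdash' u:\forall x\,A$; (5) from $\Gamma\vdash' u:\forall x\,A$ infer $\Gamma\vdash' u:A[x:=a]$; (6) from $\Gamma\vdash' u:A$, $X$ not free in $\Gamma$, infer $\Gamma\vdash' u:\forall X\,A$; (7) from $\Gamma\vdash' u:\forall X\,A$ infer $\Gamma\vdash' u:A[X:=G]$; (8) from $\Gamma\vdash' u:A[x:=a]$ and $a\approx_E b$ infer $\Gamma\vdash' u:A[x:=b]$; (9) from $\Gamma,\alpha:\neg B\vdash' u:\perp$ infer $\Gamma\vdash'\mu\alpha\,u:B$. -}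

module Defs where

open import Data.Nat using (ℕ; zero; suc; _≡ᵇ_)
open import Data.Bool using (if_then_else_)
open import Data.Fin using (Fin; toℕ)
open import Data.Vec using (Vec; []; _∷_; tabulate; lookup)
import Data.Vec as Vec
open import Data.List using (List; []; _∷_; map)
open import Data.Product using (Σ; ∃; _×_; _,_)
open import Relation.Binary.PropositionalEquality using (_≡_)
open import Relation.Nullary using (¬_)
open import Relation.Binary.Construct.Closure.ReflexiveTransitive using (Star)

-- λμ⁺⁺-terms, two-sorted de Bruijn indices
-- (lv i : λ-variables, bound by lam ; mv i : μ-variables, bound by mu)

infixl 7 _·_

data Tm : Set where
  lv  : ℕ → Tm
  mv  : ℕ → Tm
  lam : Tm → Tm
  mu  : Tm → Tm
  _·_ : Tm → Tm → Tm

ext : (ℕ → ℕ) → ℕ → ℕ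
ext ρ zero    = zero
ext ρ (suc n) = suc (ρ n)

ren : (ℕ → ℕ) → (ℕ → ℕ) → Tm → Tm
ren ρL ρM (lv i)  = lv (ρL i)
ren ρL ρM (mv i)  = mv (ρM i)
ren ρL ρM (lam t) = lam (ren (ext ρL) ρM t)
ren ρL ρM (mu t)  = mu (ren ρL (ext ρM) t)
ren ρL ρM (t · u) = ren ρL ρM t · ren ρL ρM u

wkL : Tm → Tm
wkL = ren suc (λ n → n)

wkM : Tm → Tm
wkM = ren (λ n → n) suc

extsL : (ℕ → Tm) → ℕ → Tm
extsL σ zero    = lv zero
extsL σ (suc n) = wkL (σ n)

extsM : (ℕ → Tm) → ℕ → Tm
extsM σ zero    = mv zero
extsM σ (suc n) = wkM (σ n)

sub : (ℕ → Tm) → (ℕ → Tm) → Tm → Tm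
sub σL σM (lv i)  = σL i
sub σL σM (mv i)  = σM i
sub σL σM (lam t) = lam (sub (extsL σL) (λ n → wkL (σM n)) t)
sub σL σM (mu t)  = mu (sub (λ n → wkM (σL n)) (extsM σM) t)
sub σL σM (t · u) = sub σL σM t · sub σL σM u

sub0L : Tm → ℕ → Tm
sub0L v zero    = v
sub0L v (suc n) = lv n

sub0M : Tm → ℕ → Tm
sub0M v zero    = v
sub0M v (suc n) = mv n

data FreeL : ℕ → Tm → Set where
  here  : ∀ {i} → FreeL i (lv i)
  inLam : ∀ {i t} → FreeL (suc i) t → FreeL i (lam t)
  inMu  : ∀ {i t} → FreeL i t → FreeL i (mu t)
  appL  : ∀ {i t u} → FreeL i t → FreeL i (t · u)
  appR  : ∀ {i t u} → FreeL i u → FreeL i (t · u)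

data HasAppLam : ℕ → Tm → Set where
  here  : ∀ {k v} → HasAppLam k (mv k · lam v)
  inLam : ∀ {k t} → HasAppLam k t → HasAppLam k (lam t)
  inMu  : ∀ {k t} → HasAppLam (suc k) t → HasAppLam k (mu t)
  appL  : ∀ {k t u} → HasAppLam k t → HasAppLam k (t · u)
  appR  : ∀ {k t u} → HasAppLam k u → HasAppLam k (t · u)

-- substitution used by (C_μ): α := λy (β (y v)), β the new μ-variable 0
σCμ : Tm → ℕ → Tm
σCμ v zero    = lam (mv zero · (lv zero · wkL (wkM v)))
σCμ v (suc n) = mv (suc n)

-- substitution used by (S_5): α := λy (β (y z)), z the new λ-variable
σS5 : ℕ → Tm
σS5 zero    = lam (mv zero · (lv zero · lv (suc zero)))
σS5 (suc n) = mv (suc n)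

-- substitution used by (S_6): y := (α v), y the λ-variable 0 of u, α the μ-variable 0
σS6 : Tm → ℕ → Tm
σS6 v zero    = mv zero · wkM v
σS6 v (suc n) = lv n

infix 4 _⇀_

data _⇀_ : Tm → Tm → Set where
  Cλ : ∀ {u v} → (lam u · v) ⇀ sub (sub0L v) mv u
  Cμ : ∀ {u v} → (mu u · v) ⇀ mu (sub lv (σCμ v) u)
  S1 : ∀ {a u v} → ((mv a · u) · v) ⇀ (mv a · u)
  S2 : ∀ {u} → mu (mu u) ⇀ mu (sub lv (sub0M (lam (lv zero))) u)
  S3 : ∀ {a b u} → (mv a · (mv b · u)) ⇀ (mv b · u)
  S4 : ∀ {b u} → (mv b · mu u) ⇀ sub lv (sub0M (lam (mv b · lv zero))) u
  S5 : ∀ {u} → HasAppLam zero u → mu u ⇀ lam (mu (sub (λ n → lv (suc n)) σS5 u))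
  S6 : ∀ {t} u v → FreeL zero u → t ≡ sub (σS6 v) mv u → mu t ⇀ v
  ξlam  : ∀ {t t'} → t ⇀ t' → lam t ⇀ lam t'
  ξmu   : ∀ {t t'} → t ⇀ t' → mu t ⇀ mu t'
  ξappL : ∀ {t t' u} → t ⇀ t' → (t · u) ⇀ (t' · u)
  ξappR : ∀ {t u u'} → u ⇀ u' → (t · u) ⇀ (t · u')

_⇀*_ : Tm → Tm → Set
_⇀*_ = Star _⇀_

Normal : Tm → Set
Normal t = ∀ t' → ¬ (t ⇀ t')

_→μ⁺⁺_ : Tm → (Tm → Set) → Set
t →μ⁺⁺ 𝒱 = (∀ u → 𝒱 u → Normal u)
         × (∀ u → 𝒱 u → t ⇀* u)
         × (∀ u → Normal u → t ⇀* u → 𝒱 u)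

idT : Tm
idT = lam (lv zero)

𝓘 : Tm
𝓘 = lam (mu (lv zero))

-- (y^n x) with x = lv 1, y = lv 0
yPow : ℕ → Tm
yPow zero    = lv (suc zero)
yPow (suc k) = lv zero · yPow k

nhat : ℕ → Tm
nhat n = lam (lam (yPow n))

tgt : ℕ → Tm
tgt n = lam (lv zero · nhat n)

-- inside λx μα : x = lv 0, α = mv 0
-- W n a = (α (x λd λy (y n̂) id a))
W : ℕ → Tm → Tm
W n a = mv zero · (((lv zero · lam (tgt n)) · idT) · a)

-- U_1 = W n₁ α ;  U_k = W n_k (𝓘 U_{k-1})
Uacc : {k : ℕ} → Tm → Vec ℕ k → Tm
Uacc acc []       = acc
Uacc acc (n ∷ ns) = Uacc (W n (𝓘 · acc)) ns

U : {m : ℕ} → Vec ℕ (suc m) → Tm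
U (n ∷ ns) = Uacc (W n (mv zero)) ns

P : {m : ℕ} → Vec ℕ (suc m) → Tm
P ns = lam (mu (U ns))

data FTm : Set where
  fvar  : ℕ → FTm
  fzero : FTm
  fsuc  : FTm → FTm

substT : (ℕ → FTm) → FTm → FTm
substT σ (fvar i)  = σ i
substT σ fzero     = fzero
substT σ (fsuc a)  = fsuc (substT σ a)

extsF : (ℕ → FTm) → ℕ → FTm
extsF σ zero    = fvar zero
extsF σ (suc n) = substT (λ i → fvar (suc i)) (σ n)

extsFN : ℕ → (ℕ → FTm) → ℕ → FTm
extsFN zero    σ = σ
extsFN (suc k) σ = extsF (extsFN k σ)

sub1 : FTm → ℕ → FTm
sub1 a zero    = a
sub1 a (suc n) = fvar n

-- second-order formulas; first-order variables are de Bruijn indices,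
-- second-order variables of arity k are de Bruijn indices among the
-- arity-k variables (∀₂ k binds index 0 of arity k).

infixr 5 _⇒_

data Form : Set where
  ⊥'   : Form
  _⇒_  : Form → Form → Form
  ∀₁   : Form → Form
  ∀₂   : ℕ → Form → Form
  atom : (k i : ℕ) → Vec FTm k → Form

¬' : Form → Form
¬' A = A ⇒ ⊥'

substF : (ℕ → FTm) → Form → Form
substF σ ⊥'            = ⊥'
substF σ (A ⇒ B)       = substF σ A ⇒ substF σ B
substF σ (∀₁ A)        = ∀₁ (substF (extsF σ) A)
substF σ (∀₂ k A)      = ∀₂ k (substF σ A)
substF σ (atom k i ts) = atom k i (Vec.map (substT σ) ts)

shift1 : Form → Form
shift1 = substF (λ i → fvar (suc i))

_[_]₁ : Form → FTm → Form
A [ a ]₁ = substF (sub1 a) A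

lift2 : ℕ → (ℕ → ℕ → ℕ) → ℕ → ℕ → ℕ
lift2 k ρ k' i = if k' ≡ᵇ k then ext (ρ k') i else ρ k' i

ren2 : (ℕ → ℕ → ℕ) → Form → Form
ren2 ρ ⊥'            = ⊥'
ren2 ρ (A ⇒ B)       = ren2 ρ A ⇒ ren2 ρ B
ren2 ρ (∀₁ A)        = ∀₁ (ren2 ρ A)
ren2 ρ (∀₂ k A)      = ∀₂ k (ren2 (lift2 k ρ) A)
ren2 ρ (atom k i ts) = atom k (ρ k i) ts

shift2 : ℕ → Form → Form
shift2 k = ren2 (λ k' i → if k' ≡ᵇ k then suc i else i)

-- the parameters x₀,…,x_{k-1} of a k-ary comprehension
params : (k : ℕ) → Vec FTm k
params k = tabulate (λ j → fvar (toℕ j))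

inst : {k : ℕ} → Vec FTm k → ℕ → FTm
inst []       j       = fvar j
inst (a ∷ as) zero    = a
inst (a ∷ as) (suc j) = inst as j

-- second-order substitution: ρ k i is a formula whose first-order
-- variables 0..k-1 are the parameters (others: free variables shifted by k)
SubEnv : Set
SubEnv = ℕ → ℕ → Form

liftEnv1 : SubEnv → SubEnv
liftEnv1 ρ k i = substF (extsFN k (λ j → fvar (suc j))) (ρ k i)

liftEnv2 : ℕ → SubEnv → SubEnv
liftEnv2 k ρ k' zero    = if k' ≡ᵇ k then atom k' zero (params k') else shift2 k (ρ k' zero)
liftEnv2 k ρ k' (suc i) = if k' ≡ᵇ k then shift2 k (ρ k' i) else shift2 k (ρ k' (suc i))

subst2 : SubEnv → Form → Form
subst2 ρ ⊥'            = ⊥'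
subst2 ρ (A ⇒ B)       = subst2 ρ A ⇒ subst2 ρ B
subst2 ρ (∀₁ A)        = ∀₁ (subst2 (liftEnv1 ρ) A)
subst2 ρ (∀₂ k A)      = ∀₂ k (subst2 (liftEnv2 k ρ) A)
subst2 ρ (atom k i ts) = substF (inst ts) (ρ k i)

sub0Env : ℕ → Form → SubEnv
sub0Env k G k' zero    = if k' ≡ᵇ k then G else atom k' zero (params k')
sub0Env k G k' (suc i) = if k' ≡ᵇ k then atom k' i (params k') else atom k' (suc i) (params k')

_[_≔_]₂ : Form → ℕ → Form → Form
A [ k ≔ G ]₂ = subst2 (sub0Env k G) A

Equations : Set₁
Equations = FTm → FTm → Set

data _≈[_]_ : FTm → Equations → FTm → Set₁ where
  ax    : ∀ {E a b} → E a b → (σ : ℕ → FTm) → substT σ a ≈[ E ] substT σ b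
  refl' : ∀ {E a} → a ≈[ E ] a
  sym'  : ∀ {E a b} → a ≈[ E ] b → b ≈[ E ] a
  trans' : ∀ {E a b c} → a ≈[ E ] b → b ≈[ E ] c → a ≈[ E ] c
  cong-s : ∀ {E a b} → a ≈[ E ] b → fsuc a ≈[ E ] fsuc b

-- typing  Γ ⊢' t : A ; Γ = (Γλ : types of λ-variables x_i ↦ A_i,
--                          Γμ : x_j ↦ B_j for α_j : ¬B_j)

data Has {A : Set} : List A → ℕ → A → Set where
  here  : ∀ {x xs} → Has (x ∷ xs) zero x
  there : ∀ {x y xs i} → Has xs i x → Has (y ∷ xs) (suc i) x

data _⨾_⨾_⊢'_∶_ (E : Equations) (Γλ Γμ : List Form) : Tm → Form → Set₁ where
  axλ : ∀ {i A} → Has Γλ i A → E ⨾ Γλ ⨾ Γμ ⊢' lv i ∶ A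
  axμ : ∀ {j B} → Has Γμ j B → E ⨾ Γλ ⨾ Γμ ⊢' mv j ∶ ¬' B
  →I  : ∀ {u A B} → E ⨾ (A ∷ Γλ) ⨾ Γμ ⊢' u ∶ B → E ⨾ Γλ ⨾ Γμ ⊢' lam u ∶ (A ⇒ B)
  →E  : ∀ {u v A B} → E ⨾ Γλ ⨾ Γμ ⊢' u ∶ (A ⇒ B) → E ⨾ Γλ ⨾ Γμ ⊢' v ∶ A
      → E ⨾ Γλ ⨾ Γμ ⊢' (u · v) ∶ B
  ∀₁I : ∀ {u A} → E ⨾ map shift1 Γλ ⨾ map shift1 Γμ ⊢' u ∶ A → E ⨾ Γλ ⨾ Γμ ⊢' u ∶ ∀₁ A
  ∀₁E : ∀ {u A} → E ⨾ Γλ ⨾ Γμ ⊢' u ∶ ∀₁ A → (a : FTm) → E ⨾ Γλ ⨾ Γμ ⊢' u ∶ (A [ a ]₁)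
  ∀₂I : ∀ {u A} k → E ⨾ map (shift2 k) Γλ ⨾ map (shift2 k) Γμ ⊢' u ∶ A
      → E ⨾ Γλ ⨾ Γμ ⊢' u ∶ ∀₂ k A
  ∀₂E : ∀ {u k A} → E ⨾ Γλ ⨾ Γμ ⊢' u ∶ ∀₂ k A → (G : Form)
      → E ⨾ Γλ ⨾ Γμ ⊢' u ∶ (A [ k ≔ G ]₂)
  ≈E  : ∀ {u A a b} → E ⨾ Γλ ⨾ Γμ ⊢' u ∶ (A [ a ]₁) → a ≈[ E ] b
      → E ⨾ Γλ ⨾ Γμ ⊢' u ∶ (A [ b ]₁)
  μI  : ∀ {u B} → E ⨾ Γλ ⨾ (B ∷ Γμ) ⊢' u ∶ ⊥' → E ⨾ Γλ ⨾ Γμ ⊢' mu u ∶ B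

X₀ : FTm → Form
X₀ a = atom 1 zero (a ∷ [])

Ent : FTm → Form
Ent t = ∀₂ 1 (X₀ fzero ⇒ ∀₁ (X₀ (fvar zero) ⇒ X₀ (fsuc (fvar zero))) ⇒ X₀ t)

∃' : Form → Form
∃' A = ¬' (∀₁ (¬' A))

EntTy : Form
EntTy = ∀₁ (Ent (fvar zero) ⇒ ∃' (Ent (fvar zero)))

-- Typing: Ent[x] is used at the constant predicate X := ¬∃y Ent[y] → ∃y Ent[y], so
-- λd λy (y n̂_k) inhabits X(0), id inhabits the induction step, and α, or 𝓘 applied
-- to U_{k-1}, inhabits ¬∃y Ent[y].
--
-- Reduction: with x := 0̂ = λx λy x, every (x λd λy (y n̂) id a) collapses to
-- λy (y n̂) and ignores a, so the U_k are independent "attempts" α (λy (y n̂_k)).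
-- Every reduct of (P 0̂) keeps the syntactic shape of a nest of such attempts
-- (an invariant stable under all eight rules, including the expansion (S₅) of the
-- outer μ), and the only way out of the outer μ is (S₆), which returns the
-- argument λy (y n̂_k) of an attempt that no longer mentions α. Conversely each
-- attempt k can be driven to α (λy (y n̂_k)) and extracted by (S₆).

module Submission where

open import Defs
open import Data.Nat using (ℕ; zero; suc; pred)
open import Data.Fin using (Fin; zero; suc)
open import Data.Vec using (Vec; []; _∷_; lookup)
open import Data.List using (List; []; _∷_)
open import Data.Empty using (⊥-elim)
open import Data.Sum using (_⊎_; inj₁; inj₂)
open import Data.Product using (_×_; ∃; Σ; _,_)
open import Relation.Binary.PropositionalEquality using (_≡_; _≢_; refl; cong; cong₂; sym; trans)
open import Relation.Nullary using (¬_)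
open import Relation.Binary.Construct.Closure.ReflexiveTransitive using (ε; _◅_; _◅◅_; gmap)

-- Typing

numeral : ℕ → FTm
numeral zero    = fzero
numeral (suc n) = fsuc (numeral n)

module Typing (E : Equations) where

  ∃Ent : Form
  ∃Ent = ∃' (Ent (fvar zero))

  Succ : Form
  Succ = ∀₁ (X₀ (fvar zero) ⇒ X₀ (fsuc (fvar zero)))

  yPow-typed : ∀ {Γλ Γμ} n → E ⨾ (Succ ∷ X₀ fzero ∷ Γλ) ⨾ Γμ ⊢' yPow n ∶ X₀ (numeral n)
  yPow-typed zero    = axλ (there here)
  yPow-typed (suc n) = →E (∀₁E (axλ here) (numeral n)) (yPow-typed n)

  nhat-typed : ∀ {Γλ Γμ} n → E ⨾ Γλ ⨾ Γμ ⊢' nhat n ∶ Ent (numeral n)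
  nhat-typed n = ∀₂I 1 (→I (→I (yPow-typed n)))

  tgt-typed : ∀ {Γλ Γμ} n → E ⨾ Γλ ⨾ Γμ ⊢' tgt n ∶ ∃Ent
  tgt-typed n = →I (→E (∀₁E (axλ here) (numeral n)) (nhat-typed n))

  𝓘-typed : ∀ {Γλ Γμ} → E ⨾ Γλ ⨾ Γμ ⊢' 𝓘 ∶ (⊥' ⇒ ¬' ∃Ent)
  𝓘-typed = →I (μI (axλ here))

  xCtx αCtx : List Form
  xCtx = Ent (fvar zero) ∷ []
  αCtx = ∃Ent ∷ []

  W-typed : ∀ n {a} → E ⨾ xCtx ⨾ αCtx ⊢' a ∶ ¬' ∃Ent → E ⨾ xCtx ⨾ αCtx ⊢' W n a ∶ ⊥'
  W-typed n a⦂ = →E (axμ here) (→E (→E (→E x⦂ (→I (tgt-typed n))) (∀₁I (→I (axλ here)))) a⦂)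
    where
    X : Form
    X = ¬' ∃Ent ⇒ ∃Ent

    x⦂ : E ⨾ xCtx ⨾ αCtx ⊢' lv 0 ∶ (X ⇒ ∀₁ (X ⇒ X) ⇒ X)
    x⦂ = ∀₂E (axλ here) X

  Uacc-typed : ∀ {k acc} (ns : Vec ℕ k) → E ⨾ xCtx ⨾ αCtx ⊢' acc ∶ ⊥' → E ⨾ xCtx ⨾ αCtx ⊢' Uacc acc ns ∶ ⊥'
  Uacc-typed []       acc⦂ = acc⦂
  Uacc-typed (n ∷ ns) acc⦂ = Uacc-typed ns (W-typed n (→E 𝓘-typed acc⦂))

  P-typed : ∀ {m} (ns : Vec ℕ (suc m)) → E ⨾ [] ⨾ [] ⊢' P ns ∶ EntTy
  P-typed (n ∷ ns) = ∀₁I (→I (μI (Uacc-typed ns (W-typed n (axμ here)))))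

K : Tm
K = nhat 0

constTgt : ℕ → Tm
constTgt n = lam (tgt n)

-- λy (β (y z)), what (S₅) substitutes for α: β is the μ-variable j, z the λ-variable bound by (S₅).
αExpanded : ℕ → Tm
αExpanded j = lam (mv j · (lv 0 · lv 1))

ren-yPow : ∀ {ρL ρM} n → ρL 0 ≡ 0 → ρL 1 ≡ 1 → ren ρL ρM (yPow n) ≡ yPow n
ren-yPow zero    e₀ e₁ = cong lv e₁
ren-yPow (suc n) e₀ e₁ = cong₂ _·_ (cong lv e₀) (ren-yPow n e₀ e₁)

ren-nhat : ∀ {ρL ρM} n → ren ρL ρM (nhat n) ≡ nhat n
ren-nhat n = cong (λ t → lam (lam t)) (ren-yPow n refl refl)

ren-tgt : ∀ {ρL ρM} n → ren ρL ρM (tgt n) ≡ tgt n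
ren-tgt n = cong (λ t → lam (lv 0 · t)) (ren-nhat n)

ren-constTgt : ∀ {ρL ρM} n → ren ρL ρM (constTgt n) ≡ constTgt n
ren-constTgt n = cong lam (ren-tgt n)

sub-yPow : ∀ {σL σM} n → σL 0 ≡ lv 0 → σL 1 ≡ lv 1 → sub σL σM (yPow n) ≡ yPow n
sub-yPow zero    e₀ e₁ = e₁
sub-yPow (suc n) e₀ e₁ = cong₂ _·_ e₀ (sub-yPow n e₀ e₁)

sub-nhat : ∀ {σL σM} n → sub σL σM (nhat n) ≡ nhat n
sub-nhat n = cong (λ t → lam (lam t)) (sub-yPow n refl refl)

sub-tgt : ∀ {σL σM} n → sub σL σM (tgt n) ≡ tgt n
sub-tgt n = cong (λ t → lam (lv 0 · t)) (sub-nhat n)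

sub-constTgt : ∀ {σL σM} n → sub σL σM (constTgt n) ≡ constTgt n
sub-constTgt n = cong lam (sub-tgt n)

ext-inverse : ∀ {ρ ρ'} → (∀ i → ρ' (ρ i) ≡ i) → ∀ i → ext ρ' (ext ρ i) ≡ i
ext-inverse inv zero    = refl
ext-inverse inv (suc i) = cong suc (inv i)

ren-inverse : ∀ {ρL ρM ρL' ρM'} → (∀ i → ρL' (ρL i) ≡ i) → (∀ i → ρM' (ρM i) ≡ i)
            → ∀ t → ren ρL' ρM' (ren ρL ρM t) ≡ t
ren-inverse invL invM (lv i)  = cong lv (invL i)
ren-inverse invL invM (mv i)  = cong mv (invM i)
ren-inverse invL invM (lam t) = cong lam (ren-inverse (ext-inverse invL) invM t)
ren-inverse invL invM (mu t)  = cong mu (ren-inverse invL (ext-inverse invM) t)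
ren-inverse invL invM (t · u) = cong₂ _·_ (ren-inverse invL invM t) (ren-inverse invL invM u)

wkM-injective : ∀ {t t'} → wkM t ≡ wkM t' → t ≡ t'
wkM-injective {t} {t'} e = trans (sym (unweaken t)) (trans (cong (ren (λ i → i) pred) e) (unweaken t'))
  where
  unweaken : ∀ t → ren (λ i → i) pred (wkM t) ≡ t
  unweaken = ren-inverse (λ _ → refl) (λ _ → refl)

data FreeM : ℕ → Tm → Set where
  here  : ∀ {i} → FreeM i (mv i)
  inLam : ∀ {i t} → FreeM i t → FreeM i (lam t)
  inMu  : ∀ {i t} → FreeM (suc i) t → FreeM i (mu t)
  appL  : ∀ {i t u} → FreeM i t → FreeM i (t · u)
  appR  : ∀ {i t u} → FreeM i u → FreeM i (t · u)

μClosed : Tm → Set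
μClosed t = ∀ {i} → ¬ FreeM i t

ren-FreeM : ∀ {ρL ρM i t} → FreeM i t → FreeM (ρM i) (ren ρL ρM t)
ren-FreeM here      = here
ren-FreeM (inLam f) = inLam (ren-FreeM f)
ren-FreeM (inMu f)  = inMu (ren-FreeM f)
ren-FreeM (appL f)  = appL (ren-FreeM f)
ren-FreeM (appR f)  = appR (ren-FreeM f)

ren-FreeM⁻ : ∀ {ρL ρM i} t → FreeM i (ren ρL ρM t) → ∃ λ i' → FreeM i' t × ρM i' ≡ i
ren-FreeM⁻ (mv i) here = i , here , refl
ren-FreeM⁻ (lam t) (inLam f) with ren-FreeM⁻ t f
... | i' , g , e = i' , inLam g , e
ren-FreeM⁻ (mu t) (inMu f) with ren-FreeM⁻ t f
... | suc i' , g , refl = i' , inMu g , refl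
ren-FreeM⁻ (t · u) (appL f) with ren-FreeM⁻ t f
... | i' , g , e = i' , appL g , e
ren-FreeM⁻ (t · u) (appR f) with ren-FreeM⁻ u f
... | i' , g , e = i' , appR g , e

wkM-FreeM⁻ : ∀ {i} t → FreeM (suc i) (wkM t) → FreeM i t
wkM-FreeM⁻ t f with ren-FreeM⁻ t f
... | _ , g , refl = g

wkM-not-FreeM₀ : ∀ t → ¬ FreeM 0 (wkM t)
wkM-not-FreeM₀ t f with ren-FreeM⁻ t f
... | _ , _ , ()

HasAppLam⇒FreeM : ∀ {k t} → HasAppLam k t → FreeM k t
HasAppLam⇒FreeM here      = appL here
HasAppLam⇒FreeM (inLam h) = inLam (HasAppLam⇒FreeM h)
HasAppLam⇒FreeM (inMu h)  = inMu (HasAppLam⇒FreeM h)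
HasAppLam⇒FreeM (appL h)  = appL (HasAppLam⇒FreeM h)
HasAppLam⇒FreeM (appR h)  = appR (HasAppLam⇒FreeM h)

yPow-μClosed : ∀ n → μClosed (yPow n)
yPow-μClosed (suc n) (appR f) = yPow-μClosed n f

nhat-μClosed : ∀ n → μClosed (nhat n)
nhat-μClosed n (inLam (inLam f)) = yPow-μClosed n f

tgt-μClosed : ∀ n → μClosed (tgt n)
tgt-μClosed n (inLam (appR f)) = nhat-μClosed n f

constTgt-μClosed : ∀ n → μClosed (constTgt n)
constTgt-μClosed n (inLam f) = tgt-μClosed n f

idT-μClosed : μClosed idT
idT-μClosed (inLam ())

𝓘-μClosed : μClosed 𝓘
𝓘-μClosed (inLam (inMu ()))

αExpanded-onlyFree : ∀ {i j} → FreeM i (αExpanded j) → i ≡ j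
αExpanded-onlyFree (inLam (appL here))        = refl
αExpanded-onlyFree (inLam (appR (appL ())))
αExpanded-onlyFree (inLam (appR (appR ())))

αExpanded-no-HasAppLam : ∀ {k j} → ¬ HasAppLam k (αExpanded j)
αExpanded-no-HasAppLam (inLam (appL ()))
αExpanded-no-HasAppLam (inLam (appR (appL ())))
αExpanded-no-HasAppLam (inLam (appR (appR ())))

data _⊑_ : Tm → Tm → Set where
  here  : ∀ {t} → t ⊑ t
  lam⊑  : ∀ {s t} → wkL s ⊑ t → s ⊑ lam t
  mu⊑   : ∀ {s t} → wkM s ⊑ t → s ⊑ mu t
  appL⊑ : ∀ {s t u} → s ⊑ t → s ⊑ (t · u)
  appR⊑ : ∀ {s t u} → s ⊑ u → s ⊑ (t · u)

⊑-FreeM : ∀ {i s t} → FreeM i s → s ⊑ t → FreeM i t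
⊑-FreeM f here      = f
⊑-FreeM f (lam⊑ o)  = inLam (⊑-FreeM (ren-FreeM f) o)
⊑-FreeM f (mu⊑ o)   = inMu (⊑-FreeM (ren-FreeM f) o)
⊑-FreeM f (appL⊑ o) = appL (⊑-FreeM f o)
⊑-FreeM f (appR⊑ o) = appR (⊑-FreeM f o)

sub-⊑ : ∀ {σL σM i} u → FreeL i u → σL i ⊑ sub σL σM u
sub-⊑ (lv i)  here      = here
sub-⊑ (lam u) (inLam f) = lam⊑ (sub-⊑ u f)
sub-⊑ (mu u)  (inMu f)  = mu⊑ (sub-⊑ u f)
sub-⊑ (u · v) (appL f)  = appL⊑ (sub-⊑ u f)
sub-⊑ (u · v) (appR f)  = appR⊑ (sub-⊑ v f)

mv·-FreeM : ∀ {s a w} → s ≡ mv a · w → FreeM a s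
mv·-FreeM refl = appL here

S6-redex-⊑ : ∀ {t} u v → FreeL 0 u → t ≡ sub (σS6 v) mv u → (mv 0 · wkM v) ⊑ t
S6-redex-⊑ u v f refl = sub-⊑ u f

throw-wkL-≢ : ∀ {a b} w → mv a · wkL w ≢ mv b · (lv 0 · lv 1)
throw-wkL-≢ (lv _) ()
throw-wkL-≢ (mv _) ()
throw-wkL-≢ (lam _) ()
throw-wkL-≢ (mu _) ()
throw-wkL-≢ (lv _ · _) ()
throw-wkL-≢ (mv _ · _) ()
throw-wkL-≢ (lam _ · _) ()
throw-wkL-≢ (mu _ · _) ()
throw-wkL-≢ ((_ · _) · _) ()

-- The only application of a μ-variable in αExpanded j is β (y z), whose argument mentions y.
αExpanded-no-throw : ∀ {j s a w} → s ⊑ αExpanded j → ¬ (s ≡ mv a · w)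
αExpanded-no-throw (lam⊑ o) e = no-throw o (cong wkL e)
  where
  no-throw : ∀ {j s a w} → s ⊑ (mv j · (lv 0 · lv 1)) → ¬ (s ≡ mv a · wkL w)
  no-throw {w = w} here e = throw-wkL-≢ w (sym e)
  no-throw (appL⊑ here) ()
  no-throw (appR⊑ o) e with ⊑-FreeM (mv·-FreeM e) o
  ... | appL ()
  ... | appR ()

yPow-normal : ∀ n → Normal (yPow n)
yPow-normal (suc n) _ (ξappL ())
yPow-normal (suc n) _ (ξappR s) = yPow-normal n _ s

nhat-normal : ∀ n → Normal (nhat n)
nhat-normal n _ (ξlam (ξlam s)) = yPow-normal n _ s

tgt-normal : ∀ n → Normal (tgt n)
tgt-normal n _ (ξlam (ξappL ()))
tgt-normal n _ (ξlam (ξappR s)) = nhat-normal n _ s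

constTgt-normal : ∀ n → Normal (constTgt n)
constTgt-normal n _ (ξlam s) = tgt-normal n _ s

idT-normal : Normal idT
idT-normal _ (ξlam ())

αExpanded-normal : ∀ j → Normal (αExpanded j)
αExpanded-normal j _ (ξlam (ξappL ()))
αExpanded-normal j _ (ξlam (ξappR (ξappL ())))
αExpanded-normal j _ (ξlam (ξappR (ξappR ())))

𝓘-normal : Normal 𝓘
𝓘-normal _ (ξlam (ξmu ()))
𝓘-normal _ (ξlam (S5 ()))
𝓘-normal _ (ξlam (S6 u v f eq)) with ⊑-FreeM (appL here) (S6-redex-⊑ u v f eq)
... | ()

-- The shape of the reducts

-- The head x of each attempt is still the variable, or already 0̂.
data Head : Set where
  xVar xK : Head

headTm : Head → Tm
headTm xVar = lv 0
headTm xK   = K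

headTm-μClosed : ∀ x → μClosed (headTm x)
headTm-μClosed xVar ()
headTm-μClosed xK f = nhat-μClosed 0 f

headTm-normal : ∀ x → Normal (headTm x)
headTm-normal xVar _ ()
headTm-normal xK   _ s = nhat-normal 0 _ s

start-head-μClosed : ∀ x n → μClosed ((headTm x · constTgt n) · idT)
start-head-μClosed x n (appL (appL f)) = headTm-μClosed x f
start-head-μClosed x n (appL (appR f)) = constTgt-μClosed n f
start-head-μClosed x n (appR f)        = idT-μClosed f

dropId-head-μClosed : ∀ n → μClosed (lam (constTgt n) · idT)
dropId-head-μClosed n (appL (inLam f)) = constTgt-μClosed n f
dropId-head-μClosed n (appR f)         = idT-μClosed f

start-head-step : ∀ x n {t'} → (headTm x · constTgt n) · idT ⇀ t' → x ≡ xK × t' ≡ lam (constTgt n) · idT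
start-head-step xVar n (ξappL (ξappL ()))
start-head-step xK   n (ξappL (ξappL s)) = ⊥-elim (nhat-normal 0 _ s)
start-head-step x    n (ξappL (ξappR s)) = ⊥-elim (constTgt-normal n _ s)
start-head-step x    n (ξappR s)         = ⊥-elim (idT-normal _ s)
start-head-step xK   n (ξappL Cλ)        = refl , cong (λ c → lam c · idT) (ren-constTgt n)

-- Before or after (S₅) has replaced the outer α by λy (β (y z)).
data Phase : Set where
  pre post : Phase

αTm : Phase → ℕ → Tm
αTm pre  j = mv j
αTm post j = αExpanded j

module Reducts (G : ℕ → Set) where

  -- Cmd x j ph t: t is a nest of attempts α (x λd λy (y n̂) id a) with all n in G, in
  -- some stage of reduction, the outer μ-variable α being the index j.
  data Arg (x : Head) (ph : Phase) (j : ℕ) (t : Tm) : Set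
  data Body (ph : Phase) (j : ℕ) : Head → Tm → Set
  data Cmd (x : Head) (j : ℕ) : Phase → Tm → Set

  data Arg x ph j t where
    cont : t ≡ αTm ph j → Arg x ph j t
    via𝓘 : ∀ {w} → Cmd x j ph w → t ≡ 𝓘 · w → Arg x ph j t
    viaμ : ∀ {w} → Cmd x (suc j) ph w → t ≡ mu w → Arg x ph j t

  data Body ph j where
    start   : ∀ {x n a t} → G n → Arg x ph j a → t ≡ ((headTm x · constTgt n) · idT) · a → Body ph j x t
    dropId  : ∀ {n a t} → G n → Arg xK ph j a → t ≡ (lam (constTgt n) · idT) · a → Body ph j xK t
    dropArg : ∀ {n a t} → G n → Arg xK ph j a → t ≡ constTgt n · a → Body ph j xK t
    done    : ∀ {n t} → G n → t ≡ tgt n → Body ph j xK t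

  data Cmd x j where
    throw     : ∀ {b t} → Body pre j x b → t ≡ mv j · b → Cmd x j pre t
    throwExp  : ∀ {b t} → Body post j x b → t ≡ αExpanded j · b → Cmd x j post t
    throwβ    : ∀ {b t} → Body post j x b → t ≡ mv j · (b · lv 0) → Cmd x j post t
    throwDone : ∀ {n t} → G n → t ≡ mv j · (lv 0 · nhat n) → Cmd x j post t

  Arg-onlyFree  : ∀ {x ph j t i} → Arg x ph j t → FreeM i t → i ≡ j
  Body-onlyFree : ∀ {x ph j t i} → Body ph j x t → FreeM i t → i ≡ j
  Cmd-onlyFree  : ∀ {x ph j t i} → Cmd x j ph t → FreeM i t → i ≡ j

  Arg-onlyFree {ph = pre}  (cont refl) here = refl
  Arg-onlyFree {ph = post} (cont refl) f = αExpanded-onlyFree f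
  Arg-onlyFree (via𝓘 c refl) (appL f) = ⊥-elim (𝓘-μClosed f)
  Arg-onlyFree (via𝓘 c refl) (appR f) = Cmd-onlyFree c f
  Arg-onlyFree (viaμ c refl) (inMu f) with Cmd-onlyFree c f
  ... | refl = refl

  Body-onlyFree (start {x = x} g a refl) (appL (appL (appL f))) = ⊥-elim (headTm-μClosed x f)
  Body-onlyFree (start {n = n} g a refl) (appL (appL (appR f))) = ⊥-elim (constTgt-μClosed n f)
  Body-onlyFree (start g a refl) (appL (appR f)) = ⊥-elim (idT-μClosed f)
  Body-onlyFree (start g a refl) (appR f) = Arg-onlyFree a f
  Body-onlyFree (dropId {n = n} g a refl) (appL (appL (inLam f))) = ⊥-elim (constTgt-μClosed n f)
  Body-onlyFree (dropId g a refl) (appL (appR f)) = ⊥-elim (idT-μClosed f)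
  Body-onlyFree (dropId g a refl) (appR f) = Arg-onlyFree a f
  Body-onlyFree (dropArg {n = n} g a refl) (appL f) = ⊥-elim (constTgt-μClosed n f)
  Body-onlyFree (dropArg g a refl) (appR f) = Arg-onlyFree a f
  Body-onlyFree (done {n = n} g refl) f = ⊥-elim (tgt-μClosed n f)

  Cmd-onlyFree (throw b refl) (appL here) = refl
  Cmd-onlyFree (throw b refl) (appR f) = Body-onlyFree b f
  Cmd-onlyFree (throwExp b refl) (appL f) = αExpanded-onlyFree f
  Cmd-onlyFree (throwExp b refl) (appR f) = Body-onlyFree b f
  Cmd-onlyFree (throwβ b refl) (appL here) = refl
  Cmd-onlyFree (throwβ b refl) (appR (appL f)) = Body-onlyFree b f
  Cmd-onlyFree (throwDone g refl) (appL here) = refl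
  Cmd-onlyFree (throwDone {n = n} g refl) (appR (appR f)) = ⊥-elim (nhat-μClosed n f)

  Arg-FreeM : ∀ {x ph j t} → Arg x ph j t → FreeM j t
  Cmd-FreeM : ∀ {x ph j t} → Cmd x j ph t → FreeM j t

  Arg-FreeM {ph = pre}  (cont refl) = here
  Arg-FreeM {ph = post} (cont refl) = inLam (appL here)
  Arg-FreeM (via𝓘 c refl) = appR (Cmd-FreeM c)
  Arg-FreeM (viaμ c refl) = inMu (Cmd-FreeM c)

  Cmd-FreeM (throw b refl)     = appL here
  Cmd-FreeM (throwExp b refl)  = appL (inLam (appL here))
  Cmd-FreeM (throwβ b refl)    = appL here
  Cmd-FreeM (throwDone g refl) = appL here

  ren-headTm : ∀ ρL ρM x → ρL 0 ≡ 0 → ren ρL ρM (headTm x) ≡ headTm x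
  ren-headTm ρL ρM xVar e₀ = cong lv e₀
  ren-headTm ρL ρM xK   e₀ = refl

  ren-Arg  : ∀ ρL ρM {x ph j j' t} → ρL 0 ≡ 0 → ρM j ≡ j' → Arg x ph j t → Arg x ph j' (ren ρL ρM t)
  ren-Body : ∀ ρL ρM {x ph j j' t} → ρL 0 ≡ 0 → ρM j ≡ j' → Body ph j x t → Body ph j' x (ren ρL ρM t)
  ren-Cmd  : ∀ ρL ρM {x ph j j' t} → ρL 0 ≡ 0 → ρM j ≡ j' → Cmd x j ph t → Cmd x j' ph (ren ρL ρM t)

  ren-Arg ρL ρM {ph = pre}  e₀ eⱼ (cont refl) = cont (cong mv eⱼ)
  ren-Arg ρL ρM {ph = post} e₀ eⱼ (cont refl) = cont (cong₂ (λ j i → lam (mv j · (lv 0 · lv (suc i)))) eⱼ e₀)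
  ren-Arg ρL ρM e₀ eⱼ (via𝓘 c refl) = via𝓘 (ren-Cmd ρL ρM e₀ eⱼ c) refl
  ren-Arg ρL ρM e₀ eⱼ (viaμ c refl) = viaμ (ren-Cmd ρL (ext ρM) e₀ (cong suc eⱼ) c) refl

  ren-Body ρL ρM e₀ eⱼ (start {x = x} {n} {a'} g a refl) =
    start g (ren-Arg ρL ρM e₀ eⱼ a) (cong₂ (λ h c → ((h · c) · idT) · ren ρL ρM a') (ren-headTm ρL ρM x e₀) (ren-constTgt n))
  ren-Body ρL ρM e₀ eⱼ (dropId {n} {a'} g a refl) =
    dropId g (ren-Arg ρL ρM e₀ eⱼ a) (cong (λ c → (lam c · idT) · ren ρL ρM a') (ren-constTgt n))
  ren-Body ρL ρM e₀ eⱼ (dropArg {n} {a'} g a refl) =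
    dropArg g (ren-Arg ρL ρM e₀ eⱼ a) (cong (_· ren ρL ρM a') (ren-constTgt n))
  ren-Body ρL ρM e₀ eⱼ (done {n} g refl) = done g (ren-tgt n)

  ren-Cmd ρL ρM e₀ eⱼ (throw {b'} b refl) = throw (ren-Body ρL ρM e₀ eⱼ b) (cong (λ j → mv j · ren ρL ρM b') eⱼ)
  ren-Cmd ρL ρM e₀ eⱼ (throwExp {b'} b refl) =
    throwExp (ren-Body ρL ρM e₀ eⱼ b) (cong₂ (λ j i → lam (mv j · (lv 0 · lv (suc i))) · ren ρL ρM b') eⱼ e₀)
  ren-Cmd ρL ρM e₀ eⱼ (throwβ {b'} b refl) =
    throwβ (ren-Body ρL ρM e₀ eⱼ b) (cong₂ (λ j i → mv j · (ren ρL ρM b' · lv i)) eⱼ e₀)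
  ren-Cmd ρL ρM e₀ eⱼ (throwDone {n} g refl) =
    throwDone g (cong₂ _·_ (cong mv eⱼ) (cong₂ _·_ (cong lv e₀) (ren-nhat n)))

  wkM-Cmd : ∀ {x ph j t} → Cmd x j ph t → Cmd x (suc j) ph (wkM t)
  wkM-Cmd = ren-Cmd (λ i → i) suc refl refl

  sub-headTm-underμ : ∀ σL σM x → sub σL σM (headTm x) ≡ K → sub (λ i → wkM (σL i)) (extsM σM) (headTm x) ≡ K
  sub-headTm-underμ σL σM xVar e = cong wkM e
  sub-headTm-underμ σL σM xK   e = refl

  αTm-underμ : ∀ σM ph j → σM j ≡ αTm ph j → extsM σM (suc j) ≡ αTm ph (suc j)
  αTm-underμ σM pre  j e = cong wkM e
  αTm-underμ σM post j e = cong wkM e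

  sub-Arg  : ∀ σL σM {x ph j t} → sub σL σM (headTm x) ≡ K → σM j ≡ αTm ph j → Arg x pre j t → Arg xK ph j (sub σL σM t)
  sub-Body : ∀ σL σM {x ph j t} → sub σL σM (headTm x) ≡ K → σM j ≡ αTm ph j → Body pre j x t → Body ph j xK (sub σL σM t)
  sub-Cmd  : ∀ σL σM {x ph j t} → sub σL σM (headTm x) ≡ K → σM j ≡ αTm ph j → Cmd x j pre t → Cmd xK j ph (sub σL σM t)

  sub-Arg σL σM eₓ eα (cont refl) = cont eα
  sub-Arg σL σM eₓ eα (via𝓘 c refl) = via𝓘 (sub-Cmd σL σM eₓ eα c) refl
  sub-Arg σL σM {x} {ph} {j} eₓ eα (viaμ c refl) =
    viaμ (sub-Cmd _ _ (sub-headTm-underμ σL σM x eₓ) (αTm-underμ σM ph j eα) c) refl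

  sub-Body σL σM eₓ eα (start {n = n} {a'} g a refl) =
    start g (sub-Arg σL σM eₓ eα a) (cong₂ (λ h c → ((h · c) · idT) · sub σL σM a') eₓ (sub-constTgt n))
  sub-Body σL σM eₓ eα (dropId {n} {a'} g a refl) =
    dropId g (sub-Arg σL σM eₓ eα a) (cong (λ c → (lam c · idT) · sub σL σM a') (sub-constTgt n))
  sub-Body σL σM eₓ eα (dropArg {n} {a'} g a refl) =
    dropArg g (sub-Arg σL σM eₓ eα a) (cong (_· sub σL σM a') (sub-constTgt n))
  sub-Body σL σM eₓ eα (done {n} g refl) = done g (sub-tgt n)

  sub-Cmd σL σM {ph = pre}  eₓ eα (throw {b'} b refl) = throw (sub-Body σL σM eₓ eα b) (cong (_· sub σL σM b') eα)
  sub-Cmd σL σM {ph = post} eₓ eα (throw {b'} b refl) = throwExp (sub-Body σL σM eₓ eα b) (cong (_· sub σL σM b') eα)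

  Body-not-mv : ∀ {ph j x k} → ¬ Body ph j x (mv k)
  Body-not-mv (start g a ())
  Body-not-mv (dropId g a ())
  Body-not-mv (dropArg g a ())
  Body-not-mv (done g ())

  Body-not-throw : ∀ {ph j x k u} → ¬ Body ph j x (mv k · u)
  Body-not-throw (start {x = xVar} g a ())
  Body-not-throw (start {x = xK} g a ())
  Body-not-throw (dropId g a ())
  Body-not-throw (dropArg g a ())
  Body-not-throw (done g ())

  Body-not-mu : ∀ {ph j x u} → ¬ Body ph j x (mu u)
  Body-not-mu (start g a ())
  Body-not-mu (dropId g a ())
  Body-not-mu (dropArg g a ())
  Body-not-mu (done g ())

  Body-lam : ∀ {ph j x u} → Body ph j x (lam u) → x ≡ xK × ∃ λ n → G n × u ≡ lv 0 · nhat n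
  Body-lam (start g a ())
  Body-lam (dropId g a ())
  Body-lam (dropArg g a ())
  Body-lam (done {n} g refl) = refl , n , g , refl

  Cmd-not-mu : ∀ {ph j x u} → ¬ Cmd x j ph (mu u)
  Cmd-not-mu (throw b ())
  Cmd-not-mu (throwExp b ())
  Cmd-not-mu (throwβ b ())
  Cmd-not-mu (throwDone g ())

  Arg-step  : ∀ {x ph j t t'} → Arg x ph j t → t ⇀ t' → Arg x ph j t'
  Body-step : ∀ {x ph j t t'} → Body ph j x t → t ⇀ t' → Body ph j x t'
  Cmd-step  : ∀ {x ph j t t'} → Cmd x j ph t → t ⇀ t' → Cmd x j ph t'

  Arg-step {ph = pre}           (cont refl) ()
  Arg-step {ph = post} {j = j} (cont refl) s = ⊥-elim (αExpanded-normal j _ s)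
  Arg-step (via𝓘 c refl) Cλ = viaμ (wkM-Cmd c) refl
  Arg-step (via𝓘 c refl) (ξappL s) = ⊥-elim (𝓘-normal _ s)
  Arg-step (via𝓘 c refl) (ξappR s) = via𝓘 (Cmd-step c s) refl
  Arg-step (viaμ c refl) S2 = ⊥-elim (Cmd-not-mu c)
  Arg-step (viaμ c refl) (S5 h) with Cmd-onlyFree c (HasAppLam⇒FreeM h)
  ... | ()
  Arg-step (viaμ c refl) (S6 u v f eq) with Cmd-onlyFree c (⊑-FreeM (appL here) (S6-redex-⊑ u v f eq))
  ... | ()
  Arg-step (viaμ c refl) (ξmu s) = viaμ (Cmd-step c s) refl

  Body-step (start g a refl) (ξappR s) = start g (Arg-step a s) refl
  Body-step (start {x = x} {n} g a refl) (ξappL s) with start-head-step x n s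
  ... | refl , refl = dropId g a refl
  Body-step (dropId {n} {a'} g a refl) (ξappL Cλ) = dropArg g a (cong (_· a') (sub-constTgt n))
  Body-step (dropId {n} g a refl) (ξappL (ξappL (ξlam s))) = ⊥-elim (constTgt-normal n _ s)
  Body-step (dropId g a refl) (ξappL (ξappR s)) = ⊥-elim (idT-normal _ s)
  Body-step (dropId g a refl) (ξappR s) = dropId g (Arg-step a s) refl
  Body-step (dropArg {n} g a refl) Cλ = done g (sub-tgt n)
  Body-step (dropArg {n} g a refl) (ξappL s) = ⊥-elim (constTgt-normal n _ s)
  Body-step (dropArg g a refl) (ξappR s) = dropArg g (Arg-step a s) refl
  Body-step (done {n} g refl) s = ⊥-elim (tgt-normal n _ s)

  Cmd-step (throw b refl) (ξappR s) = throw (Body-step b s) refl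
  Cmd-step (throw b refl) S3 = ⊥-elim (Body-not-throw b)
  Cmd-step (throw b refl) S4 = ⊥-elim (Body-not-mu b)
  Cmd-step (throwExp b refl) Cλ = throwβ b refl
  Cmd-step {j = j} (throwExp b refl) (ξappL s) = ⊥-elim (αExpanded-normal j _ s)
  Cmd-step (throwExp b refl) (ξappR s) = throwExp (Body-step b s) refl
  Cmd-step (throwβ b refl) (ξappR (ξappL s)) = throwβ (Body-step b s) refl
  Cmd-step {j = j} (throwβ b refl) (ξappR Cλ) with Body-lam b
  ... | _ , n , g , refl = throwDone g (cong (λ t → mv j · (lv 0 · t)) (sub-nhat n))
  Cmd-step (throwβ b refl) (ξappR S1) = ⊥-elim (Body-not-throw b)
  Cmd-step (throwβ b refl) (ξappR Cμ) = ⊥-elim (Body-not-mu b)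
  Cmd-step (throwβ b refl) S3 = ⊥-elim (Body-not-mv b)
  Cmd-step (throwDone {n} g refl) (ξappR (ξappR s)) = ⊥-elim (nhat-normal n _ s)

  Arg-HasAppLam  : ∀ {x ph j t k} → Arg x ph j t → HasAppLam k t → x ≡ xK × ph ≡ pre
  Body-HasAppLam : ∀ {x ph j t k} → Body ph j x t → HasAppLam k t → x ≡ xK × ph ≡ pre
  Cmd-HasAppLam  : ∀ {x ph j t k} → Cmd x j ph t → HasAppLam k t → x ≡ xK × ph ≡ pre

  Arg-HasAppLam {ph = pre}  (cont refl) ()
  Arg-HasAppLam {ph = post} (cont refl) h = ⊥-elim (αExpanded-no-HasAppLam h)
  Arg-HasAppLam (via𝓘 c refl) (appL h) = ⊥-elim (𝓘-μClosed (HasAppLam⇒FreeM h))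
  Arg-HasAppLam (via𝓘 c refl) (appR h) = Cmd-HasAppLam c h
  Arg-HasAppLam (viaμ c refl) (inMu h) = Cmd-HasAppLam c h

  Body-HasAppLam (start {x = x} {n} g a refl) (appL h) = ⊥-elim (start-head-μClosed x n (HasAppLam⇒FreeM h))
  Body-HasAppLam (start g a refl) (appR h) = Arg-HasAppLam a h
  Body-HasAppLam (dropId {n} g a refl) (appL h) = ⊥-elim (dropId-head-μClosed n (HasAppLam⇒FreeM h))
  Body-HasAppLam (dropId g a refl) (appR h) = Arg-HasAppLam a h
  Body-HasAppLam (dropArg {n} g a refl) (appL h) = ⊥-elim (constTgt-μClosed n (HasAppLam⇒FreeM h))
  Body-HasAppLam (dropArg g a refl) (appR h) = Arg-HasAppLam a h
  Body-HasAppLam (done {n} g refl) h = ⊥-elim (tgt-μClosed n (HasAppLam⇒FreeM h))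

  Cmd-HasAppLam (throw b refl) here with Body-lam b
  ... | x≡xK , _ = x≡xK , refl
  Cmd-HasAppLam (throw b refl) (appR h) = Body-HasAppLam b h
  Cmd-HasAppLam (throwExp b refl) (appL h) = ⊥-elim (αExpanded-no-HasAppLam h)
  Cmd-HasAppLam (throwExp b refl) (appR h) = Body-HasAppLam b h
  Cmd-HasAppLam (throwβ b refl) (appR (appL h)) = Body-HasAppLam b h
  Cmd-HasAppLam (throwDone {n} g refl) (appR (appR h)) = ⊥-elim (nhat-μClosed n (HasAppLam⇒FreeM h))

  -- What (S₆) can extract from the outer μ in each phase.
  Extracted : Head → Phase → Tm → Set
  Extracted x pre  w = x ≡ xK × ∃ λ n → G n × w ≡ tgt n
  Extracted x post w = ∃ λ n → G n × (w ≡ tgt n · lv 0 ⊎ w ≡ lv 0 · nhat n)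

  Extracted-wkM : ∀ x ph w → Extracted x ph (wkM w) → Extracted x ph w
  Extracted-wkM x pre  w (x≡xK , n , g , e) = x≡xK , n , g , wkM-injective (trans e (sym (ren-tgt n)))
  Extracted-wkM x post w (n , g , inj₁ e) = n , g , inj₁ (wkM-injective (trans e (sym (cong (_· lv 0) (ren-tgt n)))))
  Extracted-wkM x post w (n , g , inj₂ e) = n , g , inj₂ (wkM-injective (trans e (sym (cong (lv 0 ·_) (ren-nhat n)))))

  Body-done : ∀ {x ph j t} → Body ph j x t → ¬ FreeM j t → x ≡ xK × ∃ λ n → G n × t ≡ tgt n
  Body-done (start g a refl)   nf = ⊥-elim (nf (appR (Arg-FreeM a)))
  Body-done (dropId g a refl)  nf = ⊥-elim (nf (appR (Arg-FreeM a)))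
  Body-done (dropArg g a refl) nf = ⊥-elim (nf (appR (Arg-FreeM a)))
  Body-done (done {n} g refl)  nf = refl , n , g , refl

  Arg-S6  : ∀ {x ph j t s a w} → Arg x ph j t → s ⊑ t → s ≡ mv a · w → ¬ FreeM a w → Extracted x ph w
  Body-S6 : ∀ {x ph j t s a w} → Body ph j x t → s ⊑ t → s ≡ mv a · w → ¬ FreeM a w → Extracted x ph w
  Cmd-S6  : ∀ {x ph j t s a w} → Cmd x j ph t → s ⊑ t → s ≡ mv a · w → ¬ FreeM a w → Extracted x ph w

  Arg-S6 {ph = pre}  (cont refl) here ()
  Arg-S6 {ph = post} (cont refl) o e nf = ⊥-elim (αExpanded-no-throw o e)
  Arg-S6 (via𝓘 c refl) (appL⊑ o) e nf = ⊥-elim (𝓘-μClosed (⊑-FreeM (mv·-FreeM e) o))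
  Arg-S6 (via𝓘 c refl) (appR⊑ o) e nf = Cmd-S6 c o e nf
  Arg-S6 {x} {ph} {w = w} (viaμ c refl) (mu⊑ o) e nf =
    Extracted-wkM x ph w (Cmd-S6 c o (cong wkM e) (λ f → nf (wkM-FreeM⁻ w f)))

  Body-S6 (start {x = x} {n} g a refl) (appL⊑ o) e nf = ⊥-elim (start-head-μClosed x n (⊑-FreeM (mv·-FreeM e) o))
  Body-S6 (start g a refl) (appR⊑ o) e nf = Arg-S6 a o e nf
  Body-S6 (dropId {n} g a refl) (appL⊑ o) e nf = ⊥-elim (dropId-head-μClosed n (⊑-FreeM (mv·-FreeM e) o))
  Body-S6 (dropId g a refl) (appR⊑ o) e nf = Arg-S6 a o e nf
  Body-S6 (dropArg {n} g a refl) (appL⊑ o) e nf = ⊥-elim (constTgt-μClosed n (⊑-FreeM (mv·-FreeM e) o))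
  Body-S6 (dropArg g a refl) (appR⊑ o) e nf = Arg-S6 a o e nf
  Body-S6 (done {n} g refl) o e nf = ⊥-elim (tgt-μClosed n (⊑-FreeM (mv·-FreeM e) o))

  Cmd-S6 (throw b refl) here refl nf = Body-done b nf
  Cmd-S6 (throw b refl) (appR⊑ o) e nf = Body-S6 b o e nf
  Cmd-S6 (throwExp b refl) (appL⊑ o) e nf = ⊥-elim (αExpanded-no-throw o e)
  Cmd-S6 (throwExp b refl) (appR⊑ o) e nf = Body-S6 b o e nf
  Cmd-S6 (throwβ b refl) here refl nf with Body-done b (λ f → nf (appL f))
  ... | _ , n , g , refl = n , g , inj₁ refl
  Cmd-S6 (throwβ b refl) (appR⊑ here) refl nf = ⊥-elim (Body-not-mv b)
  Cmd-S6 (throwβ b refl) (appR⊑ (appL⊑ o)) e nf = Body-S6 b o e nf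
  Cmd-S6 (throwDone {n} g refl) here refl nf = n , g , inj₂ refl
  Cmd-S6 (throwDone {n} g refl) (appR⊑ o) e nf with ⊑-FreeM (mv·-FreeM e) o
  ... | appR f = ⊥-elim (nhat-μClosed n f)

  S6-outer : ∀ {x ph t} u v → Cmd x 0 ph t → FreeL 0 u → t ≡ sub (σS6 v) mv u → Extracted x ph v
  S6-outer {x} {ph} u v c f eq = Extracted-wkM x ph v (Cmd-S6 c (S6-redex-⊑ u v f eq) refl (wkM-not-FreeM₀ v))

  data Reduct (u : Tm) : Set where
    applied  : ∀ {t} → Cmd xVar 0 pre t → u ≡ lam (mu t) · K → Reduct u
    opened   : ∀ {t} → Cmd xK 0 pre t → u ≡ mu t → Reduct u
    expanded : ∀ {t} → Cmd xK 0 post t → u ≡ lam (mu t) → Reduct u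
    final    : ∀ {n} → G n → u ≡ tgt n → Reduct u
    finalη   : ∀ {n} → G n → u ≡ lam (tgt n · lv 0) → Reduct u

  Reduct-step : ∀ {u u'} → Reduct u → u ⇀ u' → Reduct u'
  Reduct-step (applied c refl) Cλ = opened (sub-Cmd _ _ refl refl c) refl
  Reduct-step (applied c refl) (ξappL (ξlam (ξmu s))) = applied (Cmd-step c s) refl
  Reduct-step (applied c refl) (ξappL (ξlam S2)) = ⊥-elim (Cmd-not-mu c)
  Reduct-step (applied c refl) (ξappL (ξlam (S5 h))) with Cmd-HasAppLam c h
  ... | () , _
  Reduct-step (applied c refl) (ξappL (ξlam (S6 u v f eq))) with S6-outer u v c f eq
  ... | () , _
  Reduct-step (applied c refl) (ξappR s) = ⊥-elim (nhat-normal 0 _ s)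
  Reduct-step (opened c refl) (ξmu s) = opened (Cmd-step c s) refl
  Reduct-step (opened c refl) S2 = ⊥-elim (Cmd-not-mu c)
  Reduct-step (opened c refl) (S5 h) = expanded (sub-Cmd _ σS5 refl refl c) refl
  Reduct-step (opened c refl) (S6 u v f eq) with S6-outer u v c f eq
  ... | _ , n , g , refl = final g refl
  Reduct-step (expanded c refl) (ξlam (ξmu s)) = expanded (Cmd-step c s) refl
  Reduct-step (expanded c refl) (ξlam S2) = ⊥-elim (Cmd-not-mu c)
  Reduct-step (expanded c refl) (ξlam (S5 h)) with Cmd-HasAppLam c h
  ... | _ , ()
  Reduct-step (expanded c refl) (ξlam (S6 u v f eq)) with S6-outer u v c f eq
  ... | n , g , inj₁ refl = finalη g refl
  ... | n , g , inj₂ refl = final g refl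
  Reduct-step (final {n} g refl) s = ⊥-elim (tgt-normal n _ s)
  Reduct-step (finalη {n} g refl) (ξlam Cλ) = final g (cong (λ t → lam (lv 0 · t)) (sub-nhat n))
  Reduct-step (finalη {n} g refl) (ξlam (ξappL s)) = ⊥-elim (tgt-normal n _ s)

  Reduct-steps : ∀ {u u'} → Reduct u → u ⇀* u' → Reduct u'
  Reduct-steps r ε        = r
  Reduct-steps r (s ◅ ss) = Reduct-steps (Reduct-step r s) ss

  Reduct-normal : ∀ {u} → Reduct u → Normal u → ∃ λ n → G n × u ≡ tgt n
  Reduct-normal (applied c refl) nu = ⊥-elim (nu _ Cλ)
  Reduct-normal (opened (throw (start g a refl) refl) refl) nu = ⊥-elim (nu _ (ξmu (ξappR (ξappL (ξappL Cλ)))))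
  Reduct-normal (opened (throw (dropId g a refl) refl) refl) nu = ⊥-elim (nu _ (ξmu (ξappR (ξappL Cλ))))
  Reduct-normal (opened (throw (dropArg g a refl) refl) refl) nu = ⊥-elim (nu _ (ξmu (ξappR Cλ)))
  Reduct-normal (opened (throw (done {n} g refl) refl) refl) nu =
    ⊥-elim (nu _ (S6 (lv 0) (tgt n) here (cong (mv 0 ·_) (sym (ren-tgt n)))))
  Reduct-normal (expanded (throwExp b refl) refl) nu = ⊥-elim (nu _ (ξlam (ξmu Cλ)))
  Reduct-normal (expanded (throwβ (start g a refl) refl) refl) nu = ⊥-elim (nu _ (ξlam (ξmu (ξappR (ξappL (ξappL (ξappL Cλ)))))))
  Reduct-normal (expanded (throwβ (dropId g a refl) refl) refl) nu = ⊥-elim (nu _ (ξlam (ξmu (ξappR (ξappL (ξappL Cλ))))))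
  Reduct-normal (expanded (throwβ (dropArg g a refl) refl) refl) nu = ⊥-elim (nu _ (ξlam (ξmu (ξappR (ξappL Cλ)))))
  Reduct-normal (expanded (throwβ (done g refl) refl) refl) nu = ⊥-elim (nu _ (ξlam (ξmu (ξappR Cλ))))
  Reduct-normal (expanded (throwDone {n} g refl) refl) nu =
    ⊥-elim (nu _ (ξlam (S6 (lv 0) (lv 0 · nhat n) here (cong (λ t → mv 0 · (lv 0 · t)) (sym (ren-nhat n))))))
  Reduct-normal (final {n} g refl) nu = n , g , refl
  Reduct-normal (finalη g refl) nu = ⊥-elim (nu _ (ξlam Cλ))

  Uacc-Cmd : ∀ {k acc} (ns : Vec ℕ k) → Cmd xVar 0 pre acc → (∀ i → G (lookup ns i)) → Cmd xVar 0 pre (Uacc acc ns)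
  Uacc-Cmd []       c gs = c
  Uacc-Cmd (n ∷ ns) c gs = Uacc-Cmd ns (throw (start (gs zero) (via𝓘 c refl) refl) refl) (λ i → gs (suc i))

  U-Cmd : ∀ {m} (ns : Vec ℕ (suc m)) → (∀ i → G (lookup ns i)) → Cmd xVar 0 pre (U ns)
  U-Cmd (n ∷ ns) gs = Uacc-Cmd ns (throw (start (gs zero) (cont refl) refl) refl) (λ i → gs (suc i))

-- Reaching each λy (y n̂_k)

⇀-≡ : ∀ {a b c} → a ⇀ b → b ≡ c → a ⇀ c
⇀-≡ s refl = s

-- W and Uacc with x := 0̂
WK : ℕ → Tm → Tm
WK n a = mv 0 · (((K · constTgt n) · idT) · a)

UaccK : ∀ {k} → Tm → Vec ℕ k → Tm
UaccK acc []       = acc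
UaccK acc (n ∷ ns) = UaccK (WK n (𝓘 · acc)) ns

-- the body of λx μα U, reduced against 0̂
substK : Tm → Tm
substK = sub (λ i → wkM (sub0L K i)) (extsM mv)

substK-W : ∀ n a → substK (W n a) ≡ WK n (substK a)
substK-W n a = cong (λ c → mv 0 · (((K · c) · idT) · substK a)) (sub-constTgt n)

substK-Uacc : ∀ {k} acc (ns : Vec ℕ k) → substK (Uacc acc ns) ≡ UaccK (substK acc) ns
substK-Uacc acc []       = refl
substK-Uacc acc (n ∷ ns) = trans (substK-Uacc _ ns) (cong (λ a → UaccK a ns) (substK-W n (𝓘 · acc)))

WK-reduces : ∀ n a → WK n a ⇀* (mv 0 · tgt n)
WK-reduces n a =
  ⇀-≡ (ξappR (ξappL (ξappL Cλ))) (cong (λ c → mv 0 · ((lam c · idT) · a)) (ren-constTgt n)) ◅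
  ⇀-≡ (ξappR (ξappL Cλ)) (cong (λ c → mv 0 · (c · a)) (sub-constTgt n)) ◅
  ⇀-≡ (ξappR Cλ) (cong (mv 0 ·_) (sub-tgt n)) ◅ ε

UaccK-cong : ∀ {k} (ns : Vec ℕ k) {acc acc'} → acc ⇀* acc' → UaccK acc ns ⇀* UaccK acc' ns
UaccK-cong []       r = r
UaccK-cong (n ∷ ns) r = UaccK-cong ns (gmap (λ a → WK n (𝓘 · a)) (λ s → ξappR (ξappR (ξappR s))) r)

UaccK-reaches : ∀ {k} n a (ns : Vec ℕ k) (i : Fin (suc k)) →
  ∃ λ k' → Σ (Vec ℕ k') λ ns' → UaccK (WK n a) ns ⇀* UaccK (mv 0 · tgt (lookup (n ∷ ns) i)) ns'
UaccK-reaches n a ns        zero    = _ , ns , UaccK-cong ns (WK-reduces n a)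
UaccK-reaches n a (n' ∷ ns) (suc i) = UaccK-reaches n' (𝓘 · WK n a) ns i

-- The accumulator sits in a hole of UaccK, so (S₆) can extract α's argument from it.
UaccK-S6-shape : ∀ {k} (ns : Vec ℕ k) v u → FreeL 0 u →
  ∃ λ u' → FreeL 0 u' × UaccK (sub (σS6 v) mv u) ns ≡ sub (σS6 v) mv u'
UaccK-S6-shape []       v u f = u , f , refl
UaccK-S6-shape (n ∷ ns) v u f with UaccK-S6-shape ns v (WK n (𝓘 · u)) (appR (appR (appR f)))
... | u' , f' , e = u' , f' , trans (cong (λ c → UaccK (mv 0 · (((K · c) · idT) · (𝓘 · sub (σS6 v) mv u))) ns) (sym (sub-constTgt n))) e

μUaccK-S6 : ∀ {k} (ns : Vec ℕ k) n → mu (UaccK (mv 0 · tgt n) ns) ⇀ tgt n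
μUaccK-S6 ns n with UaccK-S6-shape ns (tgt n) (lv 0) here
... | u , f , e = S6 u (tgt n) f (trans (cong (λ t → UaccK (mv 0 · t) ns) (sym (ren-tgt n))) e)

substK-U : ∀ {m} n (ns : Vec ℕ m) → substK (U (n ∷ ns)) ≡ UaccK (WK n (mv 0)) ns
substK-U n ns = trans (substK-Uacc (W n (mv 0)) ns) (cong (λ a → UaccK a ns) (substK-W n (mv 0)))

P·K-reaches : ∀ {m} (ns : Vec ℕ (suc m)) i → (P ns · K) ⇀* tgt (lookup ns i)
P·K-reaches (n ∷ ns) i with UaccK-reaches n (mv 0) ns i
... | _ , ns' , r = ⇀-≡ Cλ (cong mu (substK-U n ns)) ◅ gmap mu ξmu r ◅◅ μUaccK-S6 ns' _ ◅ ε

module _ {m} (ns : Vec ℕ (suc m)) where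
  open Reducts (λ k → ∃ λ (i : Fin (suc m)) → k ≡ lookup ns i)

  P·K-normal-forms : ∀ u → Normal u → (P ns · K) ⇀* u → ∃ λ (i : Fin (suc m)) → u ≡ tgt (lookup ns i)
  P·K-normal-forms u nu r with Reduct-normal (Reduct-steps (applied (U-Cmd ns (λ i → i , refl)) refl) r) nu
  ... | _ , (i , refl) , refl = i , refl

theorem10 : (E : Equations) (m : ℕ) (ns : Vec ℕ (suc m))
    → (E ⨾ [] ⨾ [] ⊢' P ns ∶ EntTy)
      × ((P ns · nhat 0) →μ⁺⁺ (λ u → ∃ λ (i : Fin (suc m)) → u ≡ tgt (lookup ns i)))
theorem10 E m ns =
  Typing.P-typed E ns ,
  (λ { _ (i , refl) → tgt-normal (lookup ns i) }) ,
  (λ { _ (i , refl) → P·K-reaches ns i }) ,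
  P·K-normal-forms ns
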